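{- Let $\mathcal{M}$ be the set of Motzkin meanders that contain neither $DU$ nor $HH$ as a contiguous subword, and let $S(u)=\sum_{w\in\mathcal{M}} z^{|w|}u^{\mathrm{level}(w)}$. Put $$W=\sqrt{(1+2z+3z^2+z^3)(1-2z-z^2+z^3)},\qquad r_1=\frac{1+z^2+z^3-W}{2z(1+z)}.$$ Then $$S(u)=\frac{(1+z)(r_1-z)}{z^2(1-ur_1)},$$ and for every $j\ge0$ the generating function of the meanders in $\mathcal{M}$ ending at level $j$ is $[u^j]S(u)=\frac{(1+z)(r_1-z)}{z^2}r_1^{j}$.
   Context: A Motzkin meander is a finite word $w$ over $\{U,H,D\}$ (heights $+1,0,-1$) all of whose prefixes have nonnegative height sum; $|w|$ is its length and $\mathrm{level}(w)$ its total height sum; the empty word is included; excursions are meanders of level $0$. "Contains $XY$ as a contiguous subword" means two consecutive letters are $X$ then $Y$. Generating functions are formal power series in $z$; $W$ is the formal power series square root with constant term $1$; $[u^j]$ is coefficient extraction. -}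

module Defs where

open import Data.Nat using (ℕ; zero; suc; _∸_)
open import Data.Bool using (Bool; true; false; _∧_; _∨_; not)
open import Data.List using (List; []; _∷_; [_]; length; map; concatMap; inits; filterᵇ; foldr)
open import Data.Integer as ℤ using (ℤ; +_; 0ℤ; _≤ᵇ_)
open import Data.Rational as ℚ using (ℚ; 0ℚ; 1ℚ; _/_)
open import Relation.Nullary using (does)
open import Relation.Binary.PropositionalEquality using (_≡_)

data Step : Set where
  U H D : Step

height : Step → ℤ
height U = + 1
height H = 0ℤ
height D = ℤ.- (+ 1)

level : List Step → ℤ
level = foldr (λ s acc → height s ℤ.+ acc) 0ℤ

allᵇ : {A : Set} → (A → Bool) → List A → Bool
allᵇ p [] = true
allᵇ p (x ∷ xs) = p x ∧ allᵇ p xs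

isMeander : List Step → Bool
isMeander w = allᵇ (λ p → 0ℤ ≤ᵇ level p) (inits w)

stepEq : Step → Step → Bool
stepEq U U = true
stepEq H H = true
stepEq D D = true
stepEq _ _ = false

containsPair : Step → Step → List Step → Bool
containsPair X Y (a ∷ b ∷ w) = (stepEq a X ∧ stepEq b Y) ∨ containsPair X Y (b ∷ w)
containsPair X Y _ = false

inM : List Step → Bool
inM w = isMeander w ∧ not (containsPair D U w) ∧ not (containsPair H H w)

words : ℕ → List (List Step)
words zero = [ [] ]
words (suc n) = concatMap (λ w → map (_∷ w) (U ∷ H ∷ D ∷ [])) (words n)

countM : ℕ → ℕ → ℕ
countM n j = length (filterᵇ (λ w → inM w ∧ does (level w ℤ.≟ + j)) (words n))

Series : Set
Series = ℕ → ℚ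

_≈ₛ_ : Series → Series → Set
f ≈ₛ g = ∀ n → f n ≡ g n

sumTo : ℕ → (ℕ → ℚ) → ℚ
sumTo zero h = h zero
sumTo (suc n) h = sumTo n h ℚ.+ h (suc n)

_⊕_ : Series → Series → Series
(f ⊕ g) n = f n ℚ.+ g n

_⊖_ : Series → Series → Series
(f ⊖ g) n = f n ℚ.- g n

_⊛_ : Series → Series → Series
(f ⊛ g) n = sumTo n (λ k → f k ℚ.* g (n ∸ k))

infix 4 _≈ₛ_ _≈₂_
infixl 6 _⊕_ _⊖_
infixl 7 _⊛_

-- polynomial from its coefficient list (constant term first)
poly : List ℚ → Series
poly [] n = 0ℚ
poly (c ∷ cs) zero = c
poly (c ∷ cs) (suc n) = poly cs n

pow : Series → ℕ → Series
pow f zero = poly [ 1ℚ ]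
pow f (suc k) = f ⊛ pow f k

ℚ- : ℕ → ℚ
ℚ- k = ℤ.- (+ k) / 1

ℚ+ : ℕ → ℚ
ℚ+ k = (+ k) / 1

zS : Series
zS = poly (0ℚ ∷ 1ℚ ∷ [])

radicand : Series
radicand = poly (1ℚ ∷ ℚ+ 2 ∷ ℚ+ 3 ∷ 1ℚ ∷ []) ⊛ poly (1ℚ ∷ ℚ- 2 ∷ ℚ- 1 ∷ 1ℚ ∷ [])

Sj : ℕ → Series
Sj j n = ℚ+ (countM n j)

-- Bivariate formal power series in z and u: F n j = [z^n u^j] F

Series2 : Set
Series2 = ℕ → ℕ → ℚ

_≈₂_ : Series2 → Series2 → Set
F ≈₂ G = ∀ n j → F n j ≡ G n j

_⊛₂_ : Series2 → Series2 → Series2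
(F ⊛₂ G) n j = sumTo n (λ a → sumTo j (λ b → F a b ℚ.* G (n ∸ a) (j ∸ b)))

_⊖₂_ : Series2 → Series2 → Series2
(F ⊖₂ G) n j = F n j ℚ.- G n j

infixl 6 _⊖₂_
infixl 7 _⊛₂_

lift : Series → Series2
lift f n zero = f n
lift f n (suc j) = 0ℚ

uS : Series2
uS zero (suc zero) = 1ℚ
uS _ _ = 0ℚ

S2 : Series2
S2 n j = ℚ+ (countM n j)

-- A word of 𝓜 is read by an automaton whose state is the current level together with the
-- class of the last letter (U or none, H, D); a letter can be appended unless it creates DU
-- or HH or goes below level 0. Removing the last letter thus gives linear transfer equations
-- in z for the generating functions of the words of 𝓜 ending at level j in each class, and
-- these equations determine them coefficient by coefficient. Squaring the defining equation
-- of r₁ shows that r₁ is a root of the kernel z(1+z)r² − (1+z²+z³)r + z(1+z), and modulo the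
-- kernel (r₁ʲ, X r₁ʲ, E r₁ʲ) with X = (r₁ − z)/z and E = (X − z)/z solves the transfer
-- equations. Summing the three classes gives z²[uʲ]S = (1+z)(r₁ − z)r₁ʲ, and summing the
-- geometric series in u r₁ gives S(u).

module Submission where

open import Defs
open import Data.Nat as ℕ using (ℕ; zero; suc; _≡ᵇ_)
import Data.Nat.Properties as ℕ
open import Data.Nat.ListAction using (sum)
open import Data.Nat.ListAction.Properties using (sum-++)
open import Data.Nat.Tactic.RingSolver using (solve-∀)
import Data.Nat.Coprimality as Coprimality
open import Data.Bool using (Bool; true; false; _∧_; _∨_; not; if_then_else_)
import Data.Bool.Properties as Bool
open import Data.List using (List; []; _∷_; [_]; _∷ʳ_; _++_; map; foldl; inits; concatMap; filterᵇ; length)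
import Data.List.Properties as List
open import Data.Integer as ℤ using (ℤ; +_; -[1+_]; 0ℤ; _≤ᵇ_)
import Data.Integer.Properties as ℤ
open import Data.Rational as ℚ using (ℚ; 0ℚ; 1ℚ; mkℚ; NonZero; 1/_)
import Data.Rational.Properties as ℚ
import Data.Rational.Solver as ℚ-Solver
open import Data.Maybe using (Maybe; just; nothing)
open import Data.Product using (_×_; _,_)
open import Level using (0ℓ)
open import Algebra.Bundles using (CommutativeRing; RawRing)
open import Algebra.Structures using (IsCommutativeRing)
import Algebra.Solver.Ring.AlmostCommutativeRing as ACR
import Relation.Binary.Reasoning.Setoid
open import Relation.Nullary using (does; yes; no)
open import Relation.Binary.PropositionalEquality hiding ([_])

sumTo-cong : ∀ n {h h′ : ℕ → ℚ} → (∀ k → h k ≡ h′ k) → sumTo n h ≡ sumTo n h′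
sumTo-cong zero    h≗h′ = h≗h′ 0
sumTo-cong (suc n) h≗h′ = cong₂ ℚ._+_ (sumTo-cong n h≗h′) (h≗h′ (suc n))

sumTo-head : ∀ n h → sumTo (suc n) h ≡ h 0 ℚ.+ sumTo n (λ k → h (suc k))
sumTo-head zero    h = refl
sumTo-head (suc n) h = trans (cong (ℚ._+ h (suc (suc n))) (sumTo-head n h))
  (ℚ.+-assoc (h 0) (sumTo n (λ k → h (suc k))) (h (suc (suc n))))

sumTo-+ : ∀ n h h′ → sumTo n (λ k → h k ℚ.+ h′ k) ≡ sumTo n h ℚ.+ sumTo n h′
sumTo-+ zero    h h′ = refl
sumTo-+ (suc n) h h′ = trans (cong (ℚ._+ (h (suc n) ℚ.+ h′ (suc n))) (sumTo-+ n h h′))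
  (interchange (sumTo n h) (sumTo n h′) (h (suc n)) (h′ (suc n)))
  where
  open ℚ-Solver.+-*-Solver
  interchange : ∀ a b c d → (a ℚ.+ b) ℚ.+ (c ℚ.+ d) ≡ (a ℚ.+ c) ℚ.+ (b ℚ.+ d)
  interchange = solve 4 (λ a b c d → (a :+ b) :+ (c :+ d) := (a :+ c) :+ (b :+ d)) refl

sumTo-*ˡ : ∀ n c h → sumTo n (λ k → c ℚ.* h k) ≡ c ℚ.* sumTo n h
sumTo-*ˡ zero    c h = refl
sumTo-*ˡ (suc n) c h = trans (cong (ℚ._+ c ℚ.* h (suc n)) (sumTo-*ˡ n c h))
  (sym (ℚ.*-distribˡ-+ c (sumTo n h) (h (suc n))))

sumTo-zero : ∀ n → sumTo n (λ _ → 0ℚ) ≡ 0ℚ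
sumTo-zero zero    = refl
sumTo-zero (suc n) = cong (ℚ._+ 0ℚ) (sumTo-zero n)

sumTo-− : ∀ n h h′ → sumTo n (λ k → h k ℚ.- h′ k) ≡ sumTo n h ℚ.- sumTo n h′
sumTo-− n h h′ = trans (sumTo-+ n h (λ k → ℚ.- h′ k)) (cong (sumTo n h ℚ.+_) (negate n))
  where
  negate : ∀ n → sumTo n (λ k → ℚ.- h′ k) ≡ ℚ.- sumTo n h′
  negate zero    = refl
  negate (suc n) = trans (cong (ℚ._+ ℚ.- h′ (suc n)) (negate n)) (sym (ℚ.neg-distrib-+ (sumTo n h′) (h′ (suc n))))

0ₛ 1ₛ : Series
0ₛ = poly []
1ₛ = poly [ 1ℚ ]

const : ℚ → Series
const c = poly [ c ]

-ₛ_ : Series → Series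
(-ₛ f) n = ℚ.- f n

shift : Series → Series
shift f n = f (suc n)

scale : ℚ → Series → Series
scale c f n = c ℚ.* f n

⊛-cong : ∀ {f f′ g g′} → f ≈ₛ f′ → g ≈ₛ g′ → f ⊛ g ≈ₛ f′ ⊛ g′
⊛-cong f≈f′ g≈g′ n = sumTo-cong n (λ k → cong₂ ℚ._*_ (f≈f′ k) (g≈g′ (n ℕ.∸ k)))

⊛-suc : ∀ f g n → (f ⊛ g) (suc n) ≡ f 0 ℚ.* g (suc n) ℚ.+ (shift f ⊛ g) n
⊛-suc f g n = sumTo-head n (λ k → f k ℚ.* g (suc n ℕ.∸ k))

⊛-sucʳ : ∀ f g n → (f ⊛ g) (suc n) ≡ (f ⊛ shift g) n ℚ.+ f (suc n) ℚ.* g 0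
⊛-sucʳ f g zero    = refl
⊛-sucʳ f g (suc n) = begin
  (f ⊛ g) (suc (suc n))                                        ≡⟨ ⊛-suc f g (suc n) ⟩
  f 0 ℚ.* g (suc (suc n)) ℚ.+ (shift f ⊛ g) (suc n)            ≡⟨ cong (f 0 ℚ.* g (suc (suc n)) ℚ.+_) (⊛-sucʳ (shift f) g n) ⟩
  f 0 ℚ.* g (suc (suc n)) ℚ.+ ((shift f ⊛ shift g) n ℚ.+ f (suc (suc n)) ℚ.* g 0)
    ≡⟨ sym (ℚ.+-assoc (f 0 ℚ.* g (suc (suc n))) ((shift f ⊛ shift g) n) (f (suc (suc n)) ℚ.* g 0)) ⟩
  (f 0 ℚ.* g (suc (suc n)) ℚ.+ (shift f ⊛ shift g) n) ℚ.+ f (suc (suc n)) ℚ.* g 0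
    ≡⟨ cong (ℚ._+ f (suc (suc n)) ℚ.* g 0) (sym (⊛-suc f (shift g) n)) ⟩
  (f ⊛ shift g) (suc n) ℚ.+ f (suc (suc n)) ℚ.* g 0            ∎
  where open ≡-Reasoning

⊛-comm : ∀ f g → f ⊛ g ≈ₛ g ⊛ f
⊛-comm f g zero    = ℚ.*-comm (f 0) (g 0)
⊛-comm f g (suc n) = begin
  (f ⊛ g) (suc n)                           ≡⟨ ⊛-suc f g n ⟩
  f 0 ℚ.* g (suc n) ℚ.+ (shift f ⊛ g) n     ≡⟨ cong (f 0 ℚ.* g (suc n) ℚ.+_) (⊛-comm (shift f) g n) ⟩
  f 0 ℚ.* g (suc n) ℚ.+ (g ⊛ shift f) n     ≡⟨ swap (f 0) (g (suc n)) _ ⟩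
  (g ⊛ shift f) n ℚ.+ g (suc n) ℚ.* f 0     ≡⟨ sym (⊛-sucʳ g f n) ⟩
  (g ⊛ f) (suc n)                           ∎
  where
  open ≡-Reasoning
  open ℚ-Solver.+-*-Solver
  swap : ∀ a b c → a ℚ.* b ℚ.+ c ≡ c ℚ.+ b ℚ.* a
  swap = solve 3 (λ a b c → a :* b :+ c := c :+ b :* a) refl

⊛-distribʳ : ∀ f f′ g → (f ⊕ f′) ⊛ g ≈ₛ f ⊛ g ⊕ f′ ⊛ g
⊛-distribʳ f f′ g n = trans (sumTo-cong n (λ k → ℚ.*-distribʳ-+ (g (n ℕ.∸ k)) (f k) (f′ k)))
  (sumTo-+ n _ _)

scale-⊛ : ∀ c f g → scale c f ⊛ g ≈ₛ scale c (f ⊛ g)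
scale-⊛ c f g n = trans (sumTo-cong n (λ k → ℚ.*-assoc c (f k) (g (n ℕ.∸ k)))) (sumTo-*ˡ n c _)

shift-⊛ : ∀ f g → shift (f ⊛ g) ≈ₛ shift f ⊛ g ⊕ scale (f 0) (shift g)
shift-⊛ f g n = trans (⊛-suc f g n) (ℚ.+-comm (f 0 ℚ.* g (suc n)) ((shift f ⊛ g) n))

⊛-assoc : ∀ f g h → (f ⊛ g) ⊛ h ≈ₛ f ⊛ (g ⊛ h)
⊛-assoc f g h zero    = ℚ.*-assoc (f 0) (g 0) (h 0)
⊛-assoc f g h (suc n) = begin
  ((f ⊛ g) ⊛ h) (suc n)                                              ≡⟨ ⊛-suc (f ⊛ g) h n ⟩
  (f 0 ℚ.* g 0) ℚ.* h (suc n) ℚ.+ (shift (f ⊛ g) ⊛ h) n              ≡⟨ cong ((f 0 ℚ.* g 0) ℚ.* h (suc n) ℚ.+_) shifted ⟩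
  (f 0 ℚ.* g 0) ℚ.* h (suc n) ℚ.+ ((shift f ⊛ (g ⊛ h)) n ℚ.+ f 0 ℚ.* (shift g ⊛ h) n)
    ≡⟨ regroup (f 0) (g 0) (h (suc n)) _ _ ⟩
  f 0 ℚ.* (g 0 ℚ.* h (suc n) ℚ.+ (shift g ⊛ h) n) ℚ.+ (shift f ⊛ (g ⊛ h)) n
    ≡⟨ cong (λ t → f 0 ℚ.* t ℚ.+ (shift f ⊛ (g ⊛ h)) n) (sym (⊛-suc g h n)) ⟩
  f 0 ℚ.* (g ⊛ h) (suc n) ℚ.+ (shift f ⊛ (g ⊛ h)) n                  ≡⟨ sym (⊛-suc f (g ⊛ h) n) ⟩
  (f ⊛ (g ⊛ h)) (suc n)                                              ∎
  where
  open ≡-Reasoning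
  shifted : (shift (f ⊛ g) ⊛ h) n ≡ (shift f ⊛ (g ⊛ h)) n ℚ.+ f 0 ℚ.* (shift g ⊛ h) n
  shifted = trans (⊛-cong {g = h} (shift-⊛ f g) (λ _ → refl) n)
    (trans (⊛-distribʳ (shift f ⊛ g) (scale (f 0) (shift g)) h n)
      (cong₂ ℚ._+_ (⊛-assoc (shift f) g h n) (scale-⊛ (f 0) (shift g) h n)))
  open ℚ-Solver.+-*-Solver
  regroup : ∀ a b c d e → (a ℚ.* b) ℚ.* c ℚ.+ (d ℚ.+ a ℚ.* e) ≡ a ℚ.* (b ℚ.* c ℚ.+ e) ℚ.+ d
  regroup = solve 5 (λ a b c d e → (a :* b) :* c :+ (d :+ a :* e) := a :* (b :* c :+ e) :+ d) refl

const-⊛ : ∀ c f → const c ⊛ f ≈ₛ scale c f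
const-⊛ c f zero    = refl
const-⊛ c f (suc n) = trans (⊛-suc (const c) f n)
  (trans (cong (c ℚ.* f (suc n) ℚ.+_) vanish) (ℚ.+-identityʳ _))
  where
  vanish : (0ₛ ⊛ f) n ≡ 0ℚ
  vanish = trans (sumTo-cong n (λ k → ℚ.*-zeroˡ (f (n ℕ.∸ k)))) (sumTo-zero n)

⊛-identityˡ : ∀ f → 1ₛ ⊛ f ≈ₛ f
⊛-identityˡ f n = trans (const-⊛ 1ℚ f n) (ℚ.*-identityˡ (f n))

seriesIsCommutativeRing : IsCommutativeRing _≈ₛ_ _⊕_ _⊛_ -ₛ_ 0ₛ 1ₛ
seriesIsCommutativeRing = record
  { isRing = record
    { +-isAbelianGroup = record
      { isGroup = record
        { isMonoid = record
          { isSemigroup = record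
            { isMagma = record
              { isEquivalence = record
                { refl = λ _ → refl ; sym = λ e n → sym (e n) ; trans = λ e e′ n → trans (e n) (e′ n) }
              ; ∙-cong = λ e e′ n → cong₂ ℚ._+_ (e n) (e′ n) }
            ; assoc = λ f g h n → ℚ.+-assoc (f n) (g n) (h n) }
          ; identity = (λ f n → ℚ.+-identityˡ (f n)) , (λ f n → ℚ.+-identityʳ (f n)) }
        ; inverse = (λ f n → ℚ.+-inverseˡ (f n)) , (λ f n → ℚ.+-inverseʳ (f n))
        ; ⁻¹-cong = λ e n → cong ℚ.-_ (e n) }
      ; comm = λ f g n → ℚ.+-comm (f n) (g n) }
    ; *-cong = ⊛-cong
    ; *-assoc = ⊛-assoc
    ; *-identity = ⊛-identityˡ , (λ f n → trans (⊛-comm f 1ₛ n) (⊛-identityˡ f n))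
    ; distrib = (λ f g h n → trans (⊛-comm f (g ⊕ h) n) (trans (⊛-distribʳ g h f n)
                   (cong₂ ℚ._+_ (⊛-comm g f n) (⊛-comm h f n))))
              , (λ f g h → ⊛-distribʳ g h f) }
  ; *-comm = ⊛-comm }

seriesRing : CommutativeRing 0ℓ 0ℓ
seriesRing = record { isCommutativeRing = seriesIsCommutativeRing }

module R = CommutativeRing seriesRing
module ≈ₛ-Reasoning = Relation.Binary.Reasoning.Setoid R.setoid

ℚ-rawRing : RawRing 0ℓ 0ℓ
ℚ-rawRing = record { _≈_ = _≡_ ; _+_ = ℚ._+_ ; _*_ = ℚ._*_ ; -_ = ℚ.-_ ; 0# = 0ℚ ; 1# = 1ℚ }

const-homomorphism : ℚ-rawRing ACR.-Raw-AlmostCommutative⟶ ACR.fromCommutativeRing seriesRing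
const-homomorphism = record
  { ⟦_⟧    = const
  ; +-homo = λ a b → λ { zero → refl ; (suc n) → refl }
  ; *-homo = λ a b → λ { zero → refl ; (suc n) → sym (trans (const-⊛ a (const b) (suc n)) (ℚ.*-zeroʳ a)) }
  ; -‿homo = λ a → λ { zero → refl ; (suc n) → refl }
  ; 0-homo = λ { zero → refl ; (suc n) → refl }
  ; 1-homo = λ { zero → refl ; (suc n) → refl } }

const-≟ : (a b : ℚ) → Maybe (const a ≈ₛ const b)
const-≟ a b with a ℚ.≟ b
... | yes refl = just (λ _ → refl)
... | no _     = nothing

open import Algebra.Solver.Ring ℚ-rawRing (ACR.fromCommutativeRing seriesRing) const-homomorphism const-≟
  public using (solve; Polynomial; con; _:+_; _:-_; _:*_; :-_; _:=_)

zS-⊛-zero : ∀ f → (zS ⊛ f) 0 ≡ 0ℚ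
zS-⊛-zero f = ℚ.*-zeroˡ (f 0)

zS-⊛-suc : ∀ f n → (zS ⊛ f) (suc n) ≡ f n
zS-⊛-suc f n = trans (⊛-suc zS f n)
  (trans (cong₂ ℚ._+_ (ℚ.*-zeroˡ (f (suc n))) (⊛-identityˡ f n)) (ℚ.+-identityˡ (f n)))

poly-∷ : ∀ c cs → poly (c ∷ cs) ≈ₛ const c ⊕ zS ⊛ poly cs
poly-∷ c cs zero    = sym (trans (cong (c ℚ.+_) (zS-⊛-zero (poly cs))) (ℚ.+-identityʳ c))
poly-∷ c cs (suc n) = sym (trans (ℚ.+-identityˡ _) (zS-⊛-suc (poly cs) n))

zS-cancel : ∀ f → zS ⊛ f ≈ₛ 0ₛ → f ≈ₛ 0ₛ
zS-cancel f zf≈0 n = trans (sym (zS-⊛-suc f n)) (zf≈0 (suc n))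

nonZero-cancel : ∀ a {x} .{{_ : NonZero a}} → a ℚ.* x ≡ 0ℚ → x ≡ 0ℚ
nonZero-cancel a {x} ax≡0 = begin
  x                    ≡⟨ ℚ.*-identityˡ x ⟨
  1ℚ ℚ.* x             ≡⟨ cong (ℚ._* x) (ℚ.*-inverseˡ a) ⟨
  1/ a ℚ.* a ℚ.* x     ≡⟨ ℚ.*-assoc (1/ a) a x ⟩
  1/ a ℚ.* (a ℚ.* x)   ≡⟨ cong (1/ a ℚ.*_) ax≡0 ⟩
  1/ a ℚ.* 0ℚ          ≡⟨ ℚ.*-zeroʳ (1/ a) ⟩
  0ℚ                   ∎
  where open ≡-Reasoning

const-cancel : ∀ a f .{{_ : NonZero a}} → const a ⊛ f ≈ₛ 0ₛ → f ≈ₛ 0ₛ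
const-cancel a f af≈0 n = nonZero-cancel a (trans (sym (const-⊛ a f n)) (af≈0 n))

1+zS-cancel : ∀ f → (1ₛ ⊕ zS) ⊛ f ≈ₛ 0ₛ → f ≈ₛ 0ₛ
1+zS-cancel f g≈0 = vanish
  where
  coefficient : ∀ n → f n ℚ.+ (zS ⊛ f) n ≡ 0ℚ
  coefficient n = trans (cong (ℚ._+ (zS ⊛ f) n) (sym (⊛-identityˡ f n)))
    (trans (sym (⊛-distribʳ 1ₛ zS f n)) (g≈0 n))
  vanish : ∀ n → f n ≡ 0ℚ
  vanish zero    = trans (sym (ℚ.+-identityʳ (f 0)))
    (trans (cong (f 0 ℚ.+_) (sym (zS-⊛-zero f))) (coefficient 0))
  vanish (suc n) = trans (sym (ℚ.+-identityʳ (f (suc n))))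
    (trans (cong (f (suc n) ℚ.+_) (trans (sym (vanish n)) (sym (zS-⊛-suc f n)))) (coefficient (suc n)))

-- The kernel

-- Over an arbitrary raw ring, so that the same terms serve as series (S) and as solver syntax (P).
module Expressions (ring : RawRing 0ℓ 0ℓ) (fromℚ : ℚ → RawRing.Carrier ring) where
  open RawRing ring

  infixl 6 _-_
  _-_ : Carrier → Carrier → Carrier
  x - y = x + - y

  horner : Carrier → List ℚ → Carrier
  horner z []            = fromℚ 0ℚ
  horner z (c ∷ [])      = fromℚ c
  horner z (c ∷ c′ ∷ cs) = fromℚ c + z * horner z (c′ ∷ cs)

  kernel : Carrier → Carrier → Carrier
  kernel z r = z * (1# + z) * r * r - (1# + z * z + z * z * z) * r + z * (1# + z)

  radicandₑ : Carrier → Carrier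
  radicandₑ z = horner z (1ℚ ∷ ℚ+ 2 ∷ ℚ+ 3 ∷ 1ℚ ∷ []) * horner z (1ℚ ∷ ℚ- 2 ∷ ℚ- 1 ∷ 1ℚ ∷ [])

  rootDefect : Carrier → Carrier → Carrier → Carrier
  rootDefect z r W = horner z (1ℚ ∷ 0ℚ ∷ 1ℚ ∷ 1ℚ ∷ []) - W - horner z (0ℚ ∷ ℚ+ 2 ∷ []) * horner z (1ℚ ∷ 1ℚ ∷ []) * r

  -- (r − z)/z and (ratioH − z)/z, rewritten as polynomials in r by means of the kernel.
  ratioH ratioD : Carrier → Carrier → Carrier
  ratioH z r = z + (1# + z) * r * r - z * (1# + z) * r
  ratioD z r = r * (r - z + ratioH z r)

syntaxRing : ℕ → RawRing 0ℓ 0ℓ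
syntaxRing n = record
  { Carrier = Polynomial n ; _≈_ = _≡_ ; _+_ = _:+_ ; _*_ = _:*_ ; -_ = :-_ ; 0# = con 0ℚ ; 1# = con 1ℚ }

module S = Expressions R.rawRing const
module P {n : ℕ} = Expressions (syntaxRing n) con
open S

transferU-mod-kernel : ∀ z r p →
  r ⊛ p ≈ₛ z ⊛ (p ⊕ ratioH z r ⊛ p) ⊕ (-ₛ p) ⊛ kernel z r
transferU-mod-kernel = solve 3 (λ z r p →
  r :* p := z :* (p :+ P.ratioH z r :* p) :+ (:- p) :* P.kernel z r) (λ _ → refl)

transferH-mod-kernel : ∀ z r p →
  ratioH z r ⊛ p ≈ₛ z ⊛ (p ⊕ ratioD z r ⊛ p) ⊕ (-ₛ (r ⊛ p)) ⊛ kernel z r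
transferH-mod-kernel = solve 3 (λ z r p →
  P.ratioH z r :* p := z :* (p :+ P.ratioD z r :* p) :+ (:- (r :* p)) :* P.kernel z r) (λ _ → refl)

transferD-mod-kernel : ∀ z r p →
  ratioD z r ⊛ p ≈ₛ z ⊛ (r ⊛ p ⊕ (ratioH z r ⊛ (r ⊛ p) ⊕ ratioD z r ⊛ (r ⊛ p)))
                    ⊕ (-ₛ (r ⊛ (1ₛ ⊕ r) ⊛ p)) ⊛ kernel z r
transferD-mod-kernel = solve 3 (λ z r p →
  P.ratioD z r :* p := z :* (r :* p :+ (P.ratioH z r :* (r :* p) :+ P.ratioD z r :* (r :* p)))
                       :+ (:- (r :* (con 1ℚ :+ r) :* p)) :* P.kernel z r) (λ _ → refl)

classSum-mod-kernel : ∀ z r p →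
  z ⊛ (z ⊛ 1ₛ) ⊛ (p ⊕ (ratioH z r ⊛ p ⊕ ratioD z r ⊛ p))
    ≈ₛ horner z (1ℚ ∷ 1ℚ ∷ []) ⊛ (r ⊖ z) ⊛ p ⊕ (1ₛ ⊕ z ⊕ z ⊛ r) ⊛ p ⊛ kernel z r
classSum-mod-kernel = solve 3 (λ z r p →
  z :* (z :* con 1ℚ) :* (p :+ (P.ratioH z r :* p :+ P.ratioD z r :* p))
    := P.horner z (1ℚ ∷ 1ℚ ∷ []) :* (r :- z) :* p :+ (con 1ℚ :+ z :+ z :* r) :* p :* P.kernel z r) (λ _ → refl)

-- Squaring 2z(1+z)r = (1+z²+z³) − W: the discriminant (1+z²+z³)² − 4z²(1+z)² of the kernel is the radicand.
kernel-discriminant-identity : ∀ z r W →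
  z ⊛ (const (ℚ+ 4) ⊛ ((1ₛ ⊕ z) ⊛ kernel z r))
    ≈ₛ (W ⊛ W ⊖ radicandₑ z) ⊕ rootDefect z r W ⊛ (W ⊕ W ⊕ rootDefect z r W)
kernel-discriminant-identity = solve 3 (λ z r W →
  z :* (con (ℚ+ 4) :* ((con 1ℚ :+ z) :* P.kernel z r))
    := (W :* W :- P.radicandₑ z) :+ P.rootDefect z r W :* (W :+ W :+ P.rootDefect z r W)) (λ _ → refl)

≈-mod : ∀ {a b} q m → q ≈ₛ 0ₛ → a ≈ₛ b ⊕ m ⊛ q → a ≈ₛ b
≈-mod {a} {b} q m q≈0 a≈b+mq = begin
  a          ≈⟨ a≈b+mq ⟩
  b ⊕ m ⊛ q  ≈⟨ R.+-congˡ {b} (R.*-congˡ {m} q≈0) ⟩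
  b ⊕ m ⊛ 0ₛ ≈⟨ R.+-congˡ {b} (R.zeroʳ m) ⟩
  b ⊕ 0ₛ     ≈⟨ R.+-identityʳ b ⟩
  b          ∎
  where open ≈ₛ-Reasoning

poly≈horner : ∀ cs → poly cs ≈ₛ horner zS cs
poly≈horner []            zero    = refl
poly≈horner []            (suc n) = refl
poly≈horner (c ∷ [])      n       = refl
poly≈horner (c ∷ c′ ∷ cs) =
  R.trans (poly-∷ c (c′ ∷ cs)) (R.+-congˡ {const c} (R.*-congˡ {zS} (poly≈horner (c′ ∷ cs))))

kernel-root : ∀ W r → W ⊛ W ≈ₛ radicand
  → poly (0ℚ ∷ ℚ+ 2 ∷ []) ⊛ poly (1ℚ ∷ 1ℚ ∷ []) ⊛ r ≈ₛ poly (1ℚ ∷ 0ℚ ∷ 1ℚ ∷ 1ℚ ∷ []) ⊖ W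
  → kernel zS r ≈ₛ 0ₛ
kernel-root W r W²≈radicand root≈ = 1+zS-cancel _ (const-cancel (ℚ+ 4) _ (zS-cancel _ (begin
  zS ⊛ (const (ℚ+ 4) ⊛ ((1ₛ ⊕ zS) ⊛ kernel zS r))          ≈⟨ kernel-discriminant-identity zS r W ⟩
  (W ⊛ W ⊖ radicandₑ zS) ⊕ defect ⊛ (W ⊕ W ⊕ defect)        ≈⟨ R.+-cong discriminant (R.*-congʳ {W ⊕ W ⊕ defect} defect≈0) ⟩
  0ₛ ⊕ 0ₛ ⊛ (W ⊕ W ⊕ defect)                               ≈⟨ R.+-identityˡ (0ₛ ⊛ (W ⊕ W ⊕ defect)) ⟩
  0ₛ ⊛ (W ⊕ W ⊕ defect)                                    ≈⟨ R.zeroˡ (W ⊕ W ⊕ defect) ⟩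
  0ₛ                                                       ∎)))
  where
  open ≈ₛ-Reasoning
  defect = rootDefect zS r W
  discriminant : W ⊛ W ⊖ radicandₑ zS ≈ₛ 0ₛ
  discriminant n = trans (cong₂ ℚ._-_ (W²≈radicand n) (sym (radicand≈ n))) (ℚ.+-inverseʳ (radicand n))
    where
    radicand≈ = ⊛-cong (poly≈horner (1ℚ ∷ ℚ+ 2 ∷ ℚ+ 3 ∷ 1ℚ ∷ [])) (poly≈horner (1ℚ ∷ ℚ- 2 ∷ ℚ- 1 ∷ 1ℚ ∷ []))
  defect≈0 : defect ≈ₛ 0ₛ
  defect≈0 n = trans (cong₂ (λ a b → a ℚ.- W n ℚ.- b) (sym (poly≈horner (1ℚ ∷ 0ℚ ∷ 1ℚ ∷ 1ℚ ∷ []) n))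
                                                    (trans (sym (factor≈ n)) (root≈ n)))
    (ℚ.+-inverseʳ (poly (1ℚ ∷ 0ℚ ∷ 1ℚ ∷ 1ℚ ∷ []) n ℚ.- W n))
    where
    factor≈ = ⊛-cong {g = r} (⊛-cong (poly≈horner (0ℚ ∷ ℚ+ 2 ∷ [])) (poly≈horner (1ℚ ∷ 1ℚ ∷ []))) (λ _ → refl)

-- Words of 𝓜 as runs of an automaton

-- ℕ's _+_ is opened only here, as above it would clash with the ring operations in Expressions.
open import Data.Nat using (_+_)

data Ending : Set where
  endsU endsH endsD : Ending

endingOf : Step → Ending
endingOf U = endsU
endingOf H = endsH
endingOf D = endsD

-- The empty word is classed with words ending in U: neither restricts the next letter.
ending : List Step → Ending
ending = foldl (λ _ s → endingOf s) endsU

allowed : Ending → Step → Bool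
allowed endsH H = false
allowed endsD U = false
allowed _     _ = true

avoids : List Step → Bool
avoids w = not (containsPair D U w) ∧ not (containsPair H H w)

level-++ : ∀ u v → level (u ++ v) ≡ level u ℤ.+ level v
level-++ []      v = sym (ℤ.+-identityˡ (level v))
level-++ (s ∷ u) v = trans (cong (λ l → height s ℤ.+ l) (level-++ u v)) (sym (ℤ.+-assoc (height s) (level u) (level v)))

level-∷ʳ : ∀ w s → level (w ∷ʳ s) ≡ level w ℤ.+ height s
level-∷ʳ w s = trans (level-++ w [ s ]) (cong (λ l → level w ℤ.+ l) (ℤ.+-identityʳ (height s)))

ending-∷ʳ : ∀ w s → ending (w ∷ʳ s) ≡ endingOf s
ending-∷ʳ w s = List.foldl-∷ʳ (λ _ s → endingOf s) endsU s w

allᵇ-map : ∀ {A B : Set} (p : B → Bool) (f : A → B) xs → allᵇ p (map f xs) ≡ allᵇ (λ x → p (f x)) xs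
allᵇ-map p f []       = refl
allᵇ-map p f (x ∷ xs) = cong (p (f x) ∧_) (allᵇ-map p f xs)

allᵇ-inits-∷ʳ : ∀ {A : Set} (p : List A → Bool) xs x →
                allᵇ p (inits (xs ∷ʳ x)) ≡ allᵇ p (inits xs) ∧ p (xs ∷ʳ x)
allᵇ-inits-∷ʳ p []       x = trans (cong (p [] ∧_) (Bool.∧-identityʳ (p [ x ])))
  (cong (_∧ p [ x ]) (sym (Bool.∧-identityʳ (p []))))
allᵇ-inits-∷ʳ p (y ∷ xs) x = begin
  p [] ∧ allᵇ p (map (y ∷_) (inits (xs ∷ʳ x)))          ≡⟨ cong (p [] ∧_) (allᵇ-map p (y ∷_) (inits (xs ∷ʳ x))) ⟩
  p [] ∧ allᵇ p′ (inits (xs ∷ʳ x))                      ≡⟨ cong (p [] ∧_) (allᵇ-inits-∷ʳ p′ xs x) ⟩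
  p [] ∧ (allᵇ p′ (inits xs) ∧ p′ (xs ∷ʳ x))            ≡⟨ Bool.∧-assoc (p []) _ _ ⟨
  (p [] ∧ allᵇ p′ (inits xs)) ∧ p′ (xs ∷ʳ x)            ≡⟨ cong (λ b → (p [] ∧ b) ∧ p′ (xs ∷ʳ x)) (allᵇ-map p (y ∷_) (inits xs)) ⟨
  (p [] ∧ allᵇ p (map (y ∷_) (inits xs))) ∧ p′ (xs ∷ʳ x) ∎
  where
  open ≡-Reasoning
  p′ = λ ys → p (y ∷ ys)

allᵇ-inits-last : ∀ {A : Set} (p : List A → Bool) xs → allᵇ p (inits xs) ≡ true → p xs ≡ true
allᵇ-inits-last p []       all≡true = trans (sym (Bool.∧-identityʳ (p []))) all≡true
allᵇ-inits-last p (x ∷ xs) all≡true with p []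
... | true = allᵇ-inits-last (λ ys → p (x ∷ ys)) xs (trans (sym (allᵇ-map p (x ∷_) (inits xs))) all≡true)

isMeander-∷ʳ : ∀ w s → isMeander (w ∷ʳ s) ≡ isMeander w ∧ (0ℤ ≤ᵇ level w ℤ.+ height s)
isMeander-∷ʳ w s = trans (allᵇ-inits-∷ʳ (λ p → 0ℤ ≤ᵇ level p) w s)
  (cong (λ l → isMeander w ∧ (0ℤ ≤ᵇ l)) (level-∷ʳ w s))

meander-level : ∀ w → isMeander w ≡ true → level w ≡ + ℤ.∣ level w ∣
meander-level w meander with level w | allᵇ-inits-last (λ p → 0ℤ ≤ᵇ level p) w meander
... | + k      | _  = refl
... | -[1+ _ ] | ()

avoids-∷∷ : ∀ a b w → avoids (a ∷ b ∷ w) ≡ allowed (endingOf a) b ∧ avoids (b ∷ w)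
avoids-∷∷ a b w = trans (distribute (stepEq a D ∧ stepEq b U) (stepEq a H ∧ stepEq b H) _ _)
  (cong (_∧ avoids (b ∷ w)) (pair a b))
  where
  distribute : ∀ p q c d → not (p ∨ c) ∧ not (q ∨ d) ≡ (not p ∧ not q) ∧ (not c ∧ not d)
  distribute true  q     c d = refl
  distribute false true  c d = Bool.∧-zeroʳ (not c)
  distribute false false c d = refl
  pair : ∀ a b → not (stepEq a D ∧ stepEq b U) ∧ not (stepEq a H ∧ stepEq b H) ≡ allowed (endingOf a) b
  pair U b = refl
  pair H U = refl
  pair H H = refl
  pair H D = refl
  pair D U = refl
  pair D H = refl
  pair D D = refl

avoids-∷ʳ : ∀ w s → avoids (w ∷ʳ s) ≡ avoids w ∧ allowed (ending w) s
avoids-∷ʳ []          s = refl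
avoids-∷ʳ (a ∷ [])    s = trans (avoids-∷∷ a s []) (Bool.∧-identityʳ _)
avoids-∷ʳ (a ∷ b ∷ w) s = begin
  avoids (a ∷ b ∷ w ∷ʳ s)                                            ≡⟨ avoids-∷∷ a b (w ∷ʳ s) ⟩
  allowed (endingOf a) b ∧ avoids (b ∷ w ∷ʳ s)                       ≡⟨ cong (allowed (endingOf a) b ∧_) (avoids-∷ʳ (b ∷ w) s) ⟩
  allowed (endingOf a) b ∧ (avoids (b ∷ w) ∧ allowed (ending (b ∷ w)) s) ≡⟨ Bool.∧-assoc (allowed (endingOf a) b) _ _ ⟨
  (allowed (endingOf a) b ∧ avoids (b ∷ w)) ∧ allowed (ending (b ∷ w)) s ≡⟨ cong (_∧ allowed (ending (b ∷ w)) s) (avoids-∷∷ a b w) ⟨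
  avoids (a ∷ b ∷ w) ∧ allowed (ending (a ∷ b ∷ w)) s                 ∎
  where open ≡-Reasoning

State : Set
State = Maybe (ℕ × Ending)

state : List Step → State
state w = if inM w then just (ℤ.∣ level w ∣ , ending w) else nothing

step : ℕ → Ending → Step → State
step k       endsH H = nothing
step k       endsD U = nothing
step k       _     U = just (suc k , endsU)
step k       _     H = just (k , endsH)
step zero    _     D = nothing
step (suc k) _     D = just (k , endsD)

next : State → Step → State
next nothing        s = nothing
next (just (k , e)) s = step k e s

inM-∷ʳ : ∀ w s → inM (w ∷ʳ s) ≡ inM w ∧ (allowed (ending w) s ∧ (0ℤ ≤ᵇ level w ℤ.+ height s))
inM-∷ʳ w s = trans (cong₂ _∧_ (isMeander-∷ʳ w s) (avoids-∷ʳ w s)) (shuffle (isMeander w) _ (avoids w) _)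
  where
  shuffle : ∀ a b c d → (a ∧ b) ∧ (c ∧ d) ≡ (a ∧ c) ∧ (d ∧ b)
  shuffle false b c     d = refl
  shuffle true  b false d = Bool.∧-zeroʳ b
  shuffle true  b true  d = Bool.∧-comm b d

step-correct : ∀ k e s → (if allowed e s ∧ (0ℤ ≤ᵇ + k ℤ.+ height s)
                       then just (ℤ.∣ + k ℤ.+ height s ∣ , endingOf s) else nothing) ≡ step k e s
step-correct k endsU U rewrite ℕ.+-comm k 1 = refl
step-correct k endsH U rewrite ℕ.+-comm k 1 = refl
step-correct k endsD U = refl
step-correct k endsU H rewrite ℕ.+-identityʳ k = refl
step-correct k endsH H = refl
step-correct k endsD H rewrite ℕ.+-identityʳ k = refl
step-correct zero    endsU D = refl
step-correct zero    endsH D = refl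
step-correct zero    endsD D = refl
step-correct (suc k) endsU D = refl
step-correct (suc k) endsH D = refl
step-correct (suc k) endsD D = refl

meander-of-inM : ∀ w → inM w ≡ true → isMeander w ≡ true
meander-of-inM w inM≡true with isMeander w
... | true = refl

state-∷ʳ : ∀ w s → state (w ∷ʳ s) ≡ next (state w) s
state-∷ʳ w s rewrite inM-∷ʳ w s | level-∷ʳ w s | ending-∷ʳ w s with inM w in inM≡b
... | false = refl
... | true  = subst P (sym (meander-level w (meander-of-inM w inM≡b))) (step-correct ℤ.∣ level w ∣ (ending w) s)
  where
  P : ℤ → Set
  P l = (if allowed (ending w) s ∧ (0ℤ ≤ᵇ l ℤ.+ height s) then just (ℤ.∣ l ℤ.+ height s ∣ , endingOf s) else nothing)
        ≡ step ℤ.∣ l ∣ (ending w) s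

𝟙 : Bool → ℕ
𝟙 true  = 1
𝟙 false = 0

sameEnding : Ending → Ending → Bool
sameEnding endsU endsU = true
sameEnding endsH endsH = true
sameEnding endsD endsD = true
sameEnding _     _     = false

at : ℕ → Ending → State → ℕ
at j e nothing         = 0
at j e (just (k , e′)) = 𝟙 (sameEnding e′ e ∧ (k ≡ᵇ j))

∑ : {A : Set} → List A → (A → ℕ) → ℕ
∑ xs f = sum (map f xs)

sumLetters : (Step → ℕ) → ℕ
sumLetters f = f U + (f H + f D)

sumEndings : (Ending → ℕ) → ℕ
sumEndings f = f endsU + (f endsH + f endsD)

afterLetter : (State → ℕ) → State → ℕ
afterLetter Φ σ = sumLetters (λ s → Φ (next σ s))

at-after-endsU-zero : ∀ σ → afterLetter (at 0 endsU) σ ≡ 0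
at-after-endsU-zero nothing                = refl
at-after-endsU-zero (just (zero  , endsU)) = refl
at-after-endsU-zero (just (suc k , endsU)) = refl
at-after-endsU-zero (just (zero  , endsH)) = refl
at-after-endsU-zero (just (suc k , endsH)) = refl
at-after-endsU-zero (just (zero  , endsD)) = refl
at-after-endsU-zero (just (suc k , endsD)) = refl

at-after-endsU : ∀ j σ → afterLetter (at (suc j) endsU) σ ≡ at j endsU σ + at j endsH σ
at-after-endsU j nothing                = refl
at-after-endsU j (just (zero  , endsU)) = refl
at-after-endsU j (just (suc k , endsU)) = refl
at-after-endsU j (just (zero  , endsH)) = ℕ.+-identityʳ _
at-after-endsU j (just (suc k , endsH)) = ℕ.+-identityʳ _
at-after-endsU j (just (zero  , endsD)) = refl
at-after-endsU j (just (suc k , endsD)) = refl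

at-after-endsH : ∀ j σ → afterLetter (at j endsH) σ ≡ at j endsU σ + at j endsD σ
at-after-endsH j nothing                = refl
at-after-endsH j (just (zero  , endsU)) = refl
at-after-endsH j (just (suc k , endsU)) = refl
at-after-endsH j (just (zero  , endsH)) = refl
at-after-endsH j (just (suc k , endsH)) = refl
at-after-endsH j (just (zero  , endsD)) = ℕ.+-identityʳ _
at-after-endsH j (just (suc k , endsD)) = ℕ.+-identityʳ _

at-after-endsD : ∀ j σ → afterLetter (at j endsD) σ ≡ at (suc j) endsU σ + (at (suc j) endsH σ + at (suc j) endsD σ)
at-after-endsD j nothing                = refl
at-after-endsD j (just (zero  , endsU)) = refl
at-after-endsD j (just (suc k , endsU)) = sym (ℕ.+-identityʳ _)
at-after-endsD j (just (zero  , endsH)) = refl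
at-after-endsD j (just (suc k , endsH)) = sym (ℕ.+-identityʳ _)
at-after-endsD j (just (zero  , endsD)) = refl
at-after-endsD j (just (suc k , endsD)) = refl

sumLetters-cong : ∀ {f g : Step → ℕ} → (∀ s → f s ≡ g s) → sumLetters f ≡ sumLetters g
sumLetters-cong f≗g = cong₂ _+_ (f≗g U) (cong₂ _+_ (f≗g H) (f≗g D))

sumLetters-comm : ∀ (f : Step → Step → ℕ) →
                  sumLetters (λ t → sumLetters (λ s → f s t)) ≡ sumLetters (λ s → sumLetters (λ t → f s t))
sumLetters-comm f = exchange (f U U) (f U H) (f U D) (f H U) (f H H) (f H D) (f D U) (f D H) (f D D)
  where
  exchange : ∀ a b c d e f g h i →
    (a + (d + g)) + ((b + (e + h)) + (c + (f + i))) ≡ (a + (b + c)) + ((d + (e + f)) + (g + (h + i)))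
  exchange = solve-∀

∑-cong : ∀ {A : Set} (xs : List A) {f g : A → ℕ} → (∀ x → f x ≡ g x) → ∑ xs f ≡ ∑ xs g
∑-cong []       f≗g = refl
∑-cong (x ∷ xs) f≗g = cong₂ _+_ (f≗g x) (∑-cong xs f≗g)

∑-+ : ∀ {A : Set} (xs : List A) f g → ∑ xs (λ x → f x + g x) ≡ ∑ xs f + ∑ xs g
∑-+ []       f g = refl
∑-+ (x ∷ xs) f g = trans (cong (λ t → f x + g x + t) (∑-+ xs f g)) (interchange (f x) (g x) (∑ xs f) (∑ xs g))
  where
  interchange : ∀ a b c d → a + b + (c + d) ≡ a + c + (b + d)
  interchange = solve-∀

∑-zero : ∀ {A : Set} (xs : List A) → ∑ xs (λ _ → 0) ≡ 0
∑-zero []       = refl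
∑-zero (x ∷ xs) = ∑-zero xs

∑-concatMap : ∀ {A B : Set} (g : A → List B) xs f → ∑ (concatMap g xs) f ≡ ∑ xs (λ x → ∑ (g x) f)
∑-concatMap g []       f = refl
∑-concatMap g (x ∷ xs) f = begin
  sum (map f (g x ++ concatMap g xs))            ≡⟨ cong sum (List.map-++ f (g x) (concatMap g xs)) ⟩
  sum (map f (g x) ++ map f (concatMap g xs))    ≡⟨ sum-++ (map f (g x)) _ ⟩
  ∑ (g x) f + ∑ (concatMap g xs) f               ≡⟨ cong (λ t → ∑ (g x) f + t) (∑-concatMap g xs f) ⟩
  ∑ (g x) f + ∑ xs (λ x → ∑ (g x) f)             ∎
  where open ≡-Reasoning

∑-words-∷ : ∀ n f → ∑ (words (suc n)) f ≡ ∑ (words n) (λ w → sumLetters (λ s → f (s ∷ w)))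
∑-words-∷ n f = trans (∑-concatMap (λ w → map (_∷ w) (U ∷ H ∷ D ∷ [])) (words n) f)
  (∑-cong (words n) (λ w → cong (λ t → f (U ∷ w) + (f (H ∷ w) + t)) (ℕ.+-identityʳ (f (D ∷ w)))))

∑-words-∷ʳ : ∀ n f → ∑ (words (suc n)) f ≡ ∑ (words n) (λ w → sumLetters (λ s → f (w ∷ʳ s)))
∑-words-∷ʳ zero    f = ∑-words-∷ zero f
∑-words-∷ʳ (suc n) f = begin
  ∑ (words (suc (suc n))) f                                                 ≡⟨ ∑-words-∷ (suc n) f ⟩
  ∑ (words (suc n)) (λ w → sumLetters (λ s → f (s ∷ w)))                    ≡⟨ ∑-words-∷ʳ n _ ⟩
  ∑ (words n) (λ w → sumLetters (λ t → sumLetters (λ s → f (s ∷ w ∷ʳ t))))  ≡⟨ ∑-cong (words n) (λ w → sumLetters-comm (λ s t → f (s ∷ w ∷ʳ t))) ⟩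
  ∑ (words n) (λ w → sumLetters (λ s → sumLetters (λ t → f (s ∷ w ∷ʳ t))))  ≡⟨ ∑-words-∷ n _ ⟨
  ∑ (words (suc n)) (λ w → sumLetters (λ t → f (w ∷ʳ t)))                   ∎
  where open ≡-Reasoning

tally : ℕ → (State → ℕ) → ℕ
tally n Φ = ∑ (words n) (λ w → Φ (state w))

count : ℕ → ℕ → Ending → ℕ
count n j e = tally n (at j e)

tally-suc : ∀ n Φ → tally (suc n) Φ ≡ tally n (afterLetter Φ)
tally-suc n Φ = trans (∑-words-∷ʳ n _)
  (∑-cong (words n) (λ w → sumLetters-cong (λ s → cong Φ (state-∷ʳ w s))))

tally-cong : ∀ n {Φ Ψ} → (∀ σ → Φ σ ≡ Ψ σ) → tally n Φ ≡ tally n Ψ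
tally-cong n Φ≗Ψ = ∑-cong (words n) (λ w → Φ≗Ψ (state w))

tally-+ : ∀ n Φ Ψ → tally n (λ σ → Φ σ + Ψ σ) ≡ tally n Φ + tally n Ψ
tally-+ n Φ Ψ = ∑-+ (words n) (λ w → Φ (state w)) (λ w → Ψ (state w))

count-suc-endsU-zero : ∀ n → count (suc n) 0 endsU ≡ 0
count-suc-endsU-zero n =
  trans (tally-suc n (at 0 endsU)) (trans (tally-cong n at-after-endsU-zero) (∑-zero (words n)))

count-suc-endsU : ∀ n j → count (suc n) (suc j) endsU ≡ count n j endsU + count n j endsH
count-suc-endsU n j = trans (tally-suc n (at (suc j) endsU)) (trans (tally-cong n (at-after-endsU j)) (tally-+ n (at j endsU) (at j endsH)))

count-suc-endsH : ∀ n j → count (suc n) j endsH ≡ count n j endsU + count n j endsD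
count-suc-endsH n j = trans (tally-suc n (at j endsH)) (trans (tally-cong n (at-after-endsH j)) (tally-+ n (at j endsU) (at j endsD)))

count-suc-endsD : ∀ n j → count (suc n) j endsD ≡ count n (suc j) endsU + (count n (suc j) endsH + count n (suc j) endsD)
count-suc-endsD n j = trans (tally-suc n (at j endsD)) (trans (tally-cong n (at-after-endsD j))
  (trans (tally-+ n (at (suc j) endsU) (λ σ → at (suc j) endsH σ + at (suc j) endsD σ)) (cong (λ t → count n (suc j) endsU + t) (tally-+ n (at (suc j) endsH) (at (suc j) endsD)))))

length-filterᵇ : ∀ {A : Set} (p : A → Bool) xs → length (filterᵇ p xs) ≡ ∑ xs (λ x → 𝟙 (p x))
length-filterᵇ p []       = refl
length-filterᵇ p (x ∷ xs) with p x
... | true  = cong suc (length-filterᵇ p xs)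
... | false = length-filterᵇ p xs

inM-at-level : ∀ j w → 𝟙 (inM w ∧ does (level w ℤ.≟ + j)) ≡ sumEndings (λ e → at j e (state w))
inM-at-level j w with inM w in inM≡b
... | false = refl
... | true  = subst P (sym (meander-level w (meander-of-inM w inM≡b))) (by-ending (ending w))
  where
  P : ℤ → Set
  P l = 𝟙 (does (l ℤ.≟ + j)) ≡ sumEndings (λ e → at j e (just (ℤ.∣ l ∣ , ending w)))
  by-ending : ∀ e′ → 𝟙 (ℤ.∣ level w ∣ ≡ᵇ j) ≡ sumEndings (λ e → at j e (just (ℤ.∣ level w ∣ , e′)))
  by-ending endsU = sym (ℕ.+-identityʳ _)
  by-ending endsH = sym (ℕ.+-identityʳ _)
  by-ending endsD = refl

countM-endings : ∀ n j → countM n j ≡ sumEndings (count n j)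
countM-endings n j = begin
  countM n j                                                  ≡⟨ length-filterᵇ _ (words n) ⟩
  ∑ (words n) (λ w → 𝟙 (inM w ∧ does (level w ℤ.≟ + j)))      ≡⟨ ∑-cong (words n) (inM-at-level j) ⟩
  ∑ (words n) (λ w → sumEndings (λ e → at j e (state w)))     ≡⟨ ∑-+ (words n) _ _ ⟩
  count n j endsU + ∑ (words n) (λ w → at j endsH (state w) + at j endsD (state w))
                                                              ≡⟨ cong (λ t → count n j endsU + t) (∑-+ (words n) _ _) ⟩
  sumEndings (count n j)                                      ∎
  where open ≡-Reasoning

-- Transfer equations

ℚ+≡mkℚ : ∀ k → ℚ+ k ≡ mkℚ (+ k) 0 (Coprimality.sym (Coprimality.1-coprimeTo k))
ℚ+≡mkℚ k = ℚ.normalize-coprime (Coprimality.sym (Coprimality.1-coprimeTo k))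

ℚ+-+ : ∀ m n → ℚ+ (m ℕ.+ n) ≡ ℚ+ m ℚ.+ ℚ+ n
ℚ+-+ m n rewrite ℚ+≡mkℚ m | ℚ+≡mkℚ n = ℚ./-cong (sym numerators) refl
  where
  numerators : + m ℤ.* + 1 ℤ.+ + n ℤ.* + 1 ≡ + (m ℕ.+ n)
  numerators = trans (cong₂ ℤ._+_ (ℤ.*-identityʳ (+ m)) (ℤ.*-identityʳ (+ n))) (sym (ℤ.pos-+ m n))

coefficient-zero : ∀ {f} g → f ≈ₛ zS ⊛ g → f 0 ≡ 0ℚ
coefficient-zero g f≈zg = trans (f≈zg 0) (zS-⊛-zero g)

coefficient-suc : ∀ {f} g n → f ≈ₛ zS ⊛ g → f (suc n) ≡ g n
coefficient-suc g n f≈zg = trans (f≈zg (suc n)) (zS-⊛-suc g n)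

-- The equations obtained by removing the last letter of a word of 𝓜 with level j and ending e.
record TransferSolution (T : Ending → ℕ → Series) : Set where
  field
    empty  : T endsU 0 ≈ₛ 1ₛ
    into-U : ∀ j → T endsU (suc j) ≈ₛ zS ⊛ (T endsU j ⊕ T endsH j)
    into-H : ∀ j → T endsH j ≈ₛ zS ⊛ (T endsU j ⊕ T endsD j)
    into-D : ∀ j → T endsD j ≈ₛ zS ⊛ (T endsU (suc j) ⊕ (T endsH (suc j) ⊕ T endsD (suc j)))

module _ {T : Ending → ℕ → Series} (sol : TransferSolution T) where
  open TransferSolution sol

  count-coefficient : ∀ n j e → ℚ+ (count n j e) ≡ T e j n
  ℚ+-sumEndings : ∀ n j → ℚ+ (sumEndings (count n j)) ≡ T endsU j n ℚ.+ (T endsH j n ℚ.+ T endsD j n)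

  count-coefficient zero    zero    endsU = sym (empty 0)
  count-coefficient zero    (suc j) endsU = sym (coefficient-zero (T endsU j ⊕ T endsH j) (into-U j))
  count-coefficient zero    j       endsH = sym (coefficient-zero (T endsU j ⊕ T endsD j) (into-H j))
  count-coefficient zero    j       endsD = sym (coefficient-zero (T endsU (suc j) ⊕ (T endsH (suc j) ⊕ T endsD (suc j))) (into-D j))
  count-coefficient (suc n) zero    endsU = trans (cong ℚ+ (count-suc-endsU-zero n)) (sym (empty (suc n)))
  count-coefficient (suc n) (suc j) endsU = begin
    ℚ+ (count (suc n) (suc j) endsU)                     ≡⟨ cong ℚ+ (count-suc-endsU n j) ⟩
    ℚ+ (count n j endsU ℕ.+ count n j endsH)             ≡⟨ ℚ+-+ (count n j endsU) (count n j endsH) ⟩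
    ℚ+ (count n j endsU) ℚ.+ ℚ+ (count n j endsH)        ≡⟨ cong₂ ℚ._+_ (count-coefficient n j endsU) (count-coefficient n j endsH) ⟩
    T endsU j n ℚ.+ T endsH j n                          ≡⟨ coefficient-suc (T endsU j ⊕ T endsH j) n (into-U j) ⟨
    T endsU (suc j) (suc n)                              ∎
    where open ≡-Reasoning
  count-coefficient (suc n) j endsH = begin
    ℚ+ (count (suc n) j endsH)                           ≡⟨ cong ℚ+ (count-suc-endsH n j) ⟩
    ℚ+ (count n j endsU ℕ.+ count n j endsD)             ≡⟨ ℚ+-+ (count n j endsU) (count n j endsD) ⟩
    ℚ+ (count n j endsU) ℚ.+ ℚ+ (count n j endsD)        ≡⟨ cong₂ ℚ._+_ (count-coefficient n j endsU) (count-coefficient n j endsD) ⟩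
    T endsU j n ℚ.+ T endsD j n                          ≡⟨ coefficient-suc (T endsU j ⊕ T endsD j) n (into-H j) ⟨
    T endsH j (suc n)                                    ∎
    where open ≡-Reasoning
  count-coefficient (suc n) j endsD = begin
    ℚ+ (count (suc n) j endsD)                                    ≡⟨ cong ℚ+ (count-suc-endsD n j) ⟩
    ℚ+ (sumEndings (count n (suc j)))                             ≡⟨ ℚ+-sumEndings n (suc j) ⟩
    T endsU (suc j) n ℚ.+ (T endsH (suc j) n ℚ.+ T endsD (suc j) n) ≡⟨ coefficient-suc (T endsU (suc j) ⊕ (T endsH (suc j) ⊕ T endsD (suc j))) n (into-D j) ⟨
    T endsD j (suc n)                                             ∎
    where open ≡-Reasoning

  ℚ+-sumEndings n j = trans (ℚ+-+ (count n j endsU) _)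
    (cong₂ ℚ._+_ (count-coefficient n j endsU)
      (trans (ℚ+-+ (count n j endsH) _) (cong₂ ℚ._+_ (count-coefficient n j endsH) (count-coefficient n j endsD))))

  Sj≈classSum : ∀ j → Sj j ≈ₛ T endsU j ⊕ (T endsH j ⊕ T endsD j)
  Sj≈classSum j n = trans (cong ℚ+ (countM-endings n j)) (ℚ+-sumEndings n j)

geometricSolution : Series → Ending → ℕ → Series
geometricSolution r endsU j = pow r j
geometricSolution r endsH j = ratioH zS r ⊛ pow r j
geometricSolution r endsD j = ratioD zS r ⊛ pow r j

geometricSolution-transfer : ∀ r → kernel zS r ≈ₛ 0ₛ → TransferSolution (geometricSolution r)
geometricSolution-transfer r root = record
  { empty  = λ _ → refl
  ; into-U = λ j → ≈-mod (kernel zS r) (-ₛ pow r j) root (transferU-mod-kernel zS r (pow r j))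
  ; into-H = λ j → ≈-mod (kernel zS r) (-ₛ (r ⊛ pow r j)) root (transferH-mod-kernel zS r (pow r j))
  ; into-D = λ j → ≈-mod (kernel zS r) (-ₛ (r ⊛ (1ₛ ⊕ r) ⊛ pow r j)) root (transferD-mod-kernel zS r (pow r j)) }

column : Series2 → ℕ → Series
column F j n = F n j

sumTo-convolve-u⁰ : ∀ j (φ ψ : ℕ → ℚ) → (∀ t → ψ (suc t) ≡ 0ℚ) →
                    sumTo j (λ b → φ b ℚ.* ψ (j ℕ.∸ b)) ≡ φ j ℚ.* ψ 0
sumTo-convolve-u⁰ zero    φ ψ ψ₊≡0 = refl
sumTo-convolve-u⁰ (suc j) φ ψ ψ₊≡0 = begin
  sumTo (suc j) (λ b → φ b ℚ.* ψ (suc j ℕ.∸ b))                       ≡⟨ sumTo-head j _ ⟩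
  φ 0 ℚ.* ψ (suc j) ℚ.+ sumTo j (λ b → φ (suc b) ℚ.* ψ (j ℕ.∸ b))      ≡⟨ cong₂ ℚ._+_ (trans (cong (φ 0 ℚ.*_) (ψ₊≡0 j)) (ℚ.*-zeroʳ (φ 0)))
                                                                             (sumTo-convolve-u⁰ j (λ b → φ (suc b)) ψ ψ₊≡0) ⟩
  0ℚ ℚ.+ φ (suc j) ℚ.* ψ 0                                            ≡⟨ ℚ.+-identityˡ _ ⟩
  φ (suc j) ℚ.* ψ 0                                                   ∎
  where open ≡-Reasoning

sumTo-convolve-u¹ : ∀ j (φ ψ : ℕ → ℚ) → ψ 0 ≡ 0ℚ → (∀ t → ψ (suc (suc t)) ≡ 0ℚ) →
                    sumTo (suc j) (λ b → φ b ℚ.* ψ (suc j ℕ.∸ b)) ≡ φ j ℚ.* ψ 1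
sumTo-convolve-u¹ zero    φ ψ ψ₀≡0 ψ₊₊≡0 =
  trans (cong (φ 0 ℚ.* ψ 1 ℚ.+_) (trans (cong (φ 1 ℚ.*_) ψ₀≡0) (ℚ.*-zeroʳ (φ 1)))) (ℚ.+-identityʳ _)
sumTo-convolve-u¹ (suc j) φ ψ ψ₀≡0 ψ₊₊≡0 = begin
  sumTo (suc (suc j)) (λ b → φ b ℚ.* ψ (suc (suc j) ℕ.∸ b))                       ≡⟨ sumTo-head (suc j) _ ⟩
  φ 0 ℚ.* ψ (suc (suc j)) ℚ.+ sumTo (suc j) (λ b → φ (suc b) ℚ.* ψ (suc j ℕ.∸ b))  ≡⟨ cong₂ ℚ._+_ (trans (cong (φ 0 ℚ.*_) (ψ₊₊≡0 j)) (ℚ.*-zeroʳ (φ 0)))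
                                                                                       (sumTo-convolve-u¹ j (λ b → φ (suc b)) ψ ψ₀≡0 ψ₊₊≡0) ⟩
  0ℚ ℚ.+ φ (suc j) ℚ.* ψ 1                                                        ≡⟨ ℚ.+-identityˡ _ ⟩
  φ (suc j) ℚ.* ψ 1                                                               ∎
  where open ≡-Reasoning

column-⊛₂-lift : ∀ F g j → column (F ⊛₂ lift g) j ≈ₛ column F j ⊛ g
column-⊛₂-lift F g j n = sumTo-cong n (λ a → sumTo-convolve-u⁰ j (F a) (lift g (n ℕ.∸ a)) (λ _ → refl))

module _ (r : Series) where
  private
    V = uS ⊛₂ lift r
    V≡ : ∀ m t → V m t ≡ (column uS t ⊛ r) m
    V≡ m t = column-⊛₂-lift uS r t m

  uS-⊛₂-lift-zero : ∀ m → V m 0 ≡ 0ℚ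
  uS-⊛₂-lift-zero m = trans (V≡ m 0) (trans (⊛-cong {column uS 0} {0ₛ} {r} (λ { zero → refl ; (suc a) → refl }) (λ _ → refl) m) (R.zeroˡ r m))

  uS-⊛₂-lift-one : ∀ m → V m 1 ≡ r m
  uS-⊛₂-lift-one m = trans (V≡ m 1) (trans (⊛-cong {column uS 1} {1ₛ} {r} (λ { zero → refl ; (suc a) → refl }) (λ _ → refl) m) (⊛-identityˡ r m))

  uS-⊛₂-lift-suc-suc : ∀ m t → V m (suc (suc t)) ≡ 0ℚ
  uS-⊛₂-lift-suc-suc m t = trans (V≡ m (suc (suc t))) (trans (⊛-cong {column uS (suc (suc t))} {0ₛ} {r} (λ { zero → refl ; (suc a) → refl }) (λ _ → refl) m) (R.zeroˡ r m))

  ⊛₂-uS-lift-zero : ∀ F n → (F ⊛₂ V) n 0 ≡ 0ℚ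
  ⊛₂-uS-lift-zero F n = trans (sumTo-cong n (λ a → trans (cong (F a 0 ℚ.*_) (uS-⊛₂-lift-zero (n ℕ.∸ a))) (ℚ.*-zeroʳ (F a 0))))
    (sumTo-zero n)

  column-⊛₂-uS-lift : ∀ F j → column (F ⊛₂ V) (suc j) ≈ₛ column F j ⊛ r
  column-⊛₂-uS-lift F j n = sumTo-cong n (λ a →
    trans (sumTo-convolve-u¹ j (F a) (V (n ℕ.∸ a)) (uS-⊛₂-lift-zero (n ℕ.∸ a)) (uS-⊛₂-lift-suc-suc (n ℕ.∸ a)))
          (cong (F a j ℚ.*_) (uS-⊛₂-lift-one (n ℕ.∸ a))))

⊛₂-⊖₂ : ∀ F A B n j → (F ⊛₂ (A ⊖₂ B)) n j ≡ (F ⊛₂ A) n j ℚ.- (F ⊛₂ B) n j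
⊛₂-⊖₂ F A B n j = trans (sumTo-cong n (λ a → trans (sumTo-cong j (λ b → *-distribˡ-− (F a b) _ _)) (sumTo-− j _ _)))
  (sumTo-− n _ _)
  where
  *-distribˡ-− : ∀ x y z → x ℚ.* (y ℚ.- z) ≡ x ℚ.* y ℚ.- x ℚ.* z
  *-distribˡ-− x y z = trans (ℚ.*-distribˡ-+ x y (ℚ.- z)) (cong (x ℚ.* y ℚ.+_) (sym (ℚ.neg-distribʳ-* x z)))

geometric-u : ∀ F C r → (∀ j → column F j ≈ₛ C ⊛ pow r j) → F ⊛₂ (lift 1ₛ ⊖₂ uS ⊛₂ lift r) ≈₂ lift C
geometric-u F C r F≈Crʲ n zero = begin
  (F ⊛₂ (lift 1ₛ ⊖₂ uS ⊛₂ lift r)) n 0              ≡⟨ ⊛₂-⊖₂ F (lift 1ₛ) (uS ⊛₂ lift r) n 0 ⟩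
  (F ⊛₂ lift 1ₛ) n 0 ℚ.- (F ⊛₂ (uS ⊛₂ lift r)) n 0  ≡⟨ cong₂ ℚ._-_ (column-⊛₂-lift F 1ₛ 0 n) (⊛₂-uS-lift-zero r F n) ⟩
  (column F 0 ⊛ 1ₛ) n ℚ.- 0ℚ                        ≡⟨ ℚ.+-identityʳ _ ⟩
  (column F 0 ⊛ 1ₛ) n                               ≡⟨ R.*-identityʳ (column F 0) n ⟩
  F n 0                                             ≡⟨ F≈Crʲ 0 n ⟩
  (C ⊛ 1ₛ) n                                        ≡⟨ R.*-identityʳ C n ⟩
  C n                                               ∎
  where open ≡-Reasoning
geometric-u F C r F≈Crʲ n (suc j) = begin
  (F ⊛₂ (lift 1ₛ ⊖₂ uS ⊛₂ lift r)) n (suc j)                   ≡⟨ ⊛₂-⊖₂ F (lift 1ₛ) (uS ⊛₂ lift r) n (suc j) ⟩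
  (F ⊛₂ lift 1ₛ) n (suc j) ℚ.- (F ⊛₂ (uS ⊛₂ lift r)) n (suc j) ≡⟨ cong₂ ℚ._-_ (column-⊛₂-lift F 1ₛ (suc j) n) (column-⊛₂-uS-lift r F j n) ⟩
  (column F (suc j) ⊛ 1ₛ) n ℚ.- (column F j ⊛ r) n             ≡⟨ cong₂ ℚ._-_ (trans (R.*-identityʳ (column F (suc j)) n) (F≈Crʲ (suc j) n))
                                                                               (⊛-cong {g = r} (F≈Crʲ j) (λ _ → refl) n) ⟩
  (C ⊛ (r ⊛ pow r j)) n ℚ.- ((C ⊛ pow r j) ⊛ r) n              ≡⟨ cong (ℚ._- ((C ⊛ pow r j) ⊛ r) n) (regroup n) ⟩
  ((C ⊛ pow r j) ⊛ r) n ℚ.- ((C ⊛ pow r j) ⊛ r) n              ≡⟨ ℚ.+-inverseʳ (((C ⊛ pow r j) ⊛ r) n) ⟩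
  0ℚ                                                           ∎
  where
  open ≡-Reasoning
  regroup : C ⊛ (r ⊛ pow r j) ≈ₛ (C ⊛ pow r j) ⊛ r
  regroup = R.trans (R.*-congˡ {C} (R.*-comm r (pow r j))) (R.sym (R.*-assoc C (pow r j) r))

mainTheorem6 : (W r₁ : Series)
    → W 0 ≡ 1ℚ
    → W ⊛ W ≈ₛ radicand
    → poly (0ℚ ∷ ℚ+ 2 ∷ []) ⊛ poly (1ℚ ∷ 1ℚ ∷ []) ⊛ r₁ ≈ₛ poly (1ℚ ∷ 0ℚ ∷ 1ℚ ∷ 1ℚ ∷ []) ⊖ W
    → (S2 ⊛₂ lift (pow zS 2) ⊛₂ (lift (poly (1ℚ ∷ [])) ⊖₂ uS ⊛₂ lift r₁)
         ≈₂ lift (poly (1ℚ ∷ 1ℚ ∷ []) ⊛ (r₁ ⊖ zS)))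
      × ((j : ℕ) → pow zS 2 ⊛ Sj j ≈ₛ poly (1ℚ ∷ 1ℚ ∷ []) ⊛ (r₁ ⊖ zS) ⊛ pow r₁ j)
mainTheorem6 W r₁ _ W²≈radicand root≈ = geometric-u _ _ r₁ column≈ , level-gf
  where
  root : kernel zS r₁ ≈ₛ 0ₛ
  root = kernel-root W r₁ W²≈radicand root≈
  level-gf : ∀ j → pow zS 2 ⊛ Sj j ≈ₛ poly (1ℚ ∷ 1ℚ ∷ []) ⊛ (r₁ ⊖ zS) ⊛ pow r₁ j
  level-gf j = begin
    pow zS 2 ⊛ Sj j                                   ≈⟨ R.*-congˡ {pow zS 2} (Sj≈classSum (geometricSolution-transfer r₁ root) j) ⟩
    pow zS 2 ⊛ (pow r₁ j ⊕ (ratioH zS r₁ ⊛ pow r₁ j ⊕ ratioD zS r₁ ⊛ pow r₁ j))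
                                                      ≈⟨ ≈-mod (kernel zS r₁) ((1ₛ ⊕ zS ⊕ zS ⊛ r₁) ⊛ pow r₁ j) root (classSum-mod-kernel zS r₁ (pow r₁ j)) ⟩
    horner zS (1ℚ ∷ 1ℚ ∷ []) ⊛ (r₁ ⊖ zS) ⊛ pow r₁ j   ≈⟨ R.*-congʳ {pow r₁ j} (R.*-congʳ {r₁ ⊖ zS} (R.sym (poly≈horner (1ℚ ∷ 1ℚ ∷ [])))) ⟩
    poly (1ℚ ∷ 1ℚ ∷ []) ⊛ (r₁ ⊖ zS) ⊛ pow r₁ j        ∎
    where open ≈ₛ-Reasoning
  column≈ : ∀ j → column (S2 ⊛₂ lift (pow zS 2)) j ≈ₛ poly (1ℚ ∷ 1ℚ ∷ []) ⊛ (r₁ ⊖ zS) ⊛ pow r₁ j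
  column≈ j = R.trans (column-⊛₂-lift S2 (pow zS 2) j) (R.trans (R.*-comm (Sj j) (pow zS 2)) (level-gf j))
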